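{- Let $X$ be a finite cell complex and let $n\ge2$. Let $\Delta_{n-1}$ be the $(n-1)$-simplex on vertex set $[n]$, and let $X\times\Delta_{n-1}$ be the product cell complex whose cells are the products $\alpha\times\beta$ of cells $\alpha$ of $X$ and simplices $\beta$ of $\Delta_{n-1}$. Then for all $k\ge0$, $$h^k(X\times\Delta_{n-1})\ \ge\ \min\Big\{h^k(X),\ \max\Big\{1,\frac{n}{k+2}\Big\}\Big\}.$$
   Context: Cochains have $\mathbb{Z}_2$ coefficients (non-reduced, $C^{ -1}=0$); $\|\phi\|$ is the number of cells where $\phi$ is nonzero, $\|\phi\|_{csy}=\min_{\psi\in C^{k-1}}\|\phi+d_{k-1}\psi\|$, and $h^k(Z)=\min\{\|d_k\phi\|/\|\phi\|_{csy}:\phi\in C^k(Z)\setminus B^k(Z)\}$ with $B^k=d_{k-1}C^{k-1}$. -}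

module Defs where

open import Data.Nat using (ℕ; zero; suc; _+_; _∸_; _≤_; _≡ᵇ_)
open import Data.Bool using (Bool; true; false; _∧_; _∨_; _xor_; not; if_then_else_)
open import Data.List using (List; []; _∷_; map; length; concatMap; _++_; foldr)
open import Data.List.Relation.Unary.All using (All)
open import Data.Fin using (Fin)
open import Data.Fin.Base as Fin using ()
open import Data.Fin.Properties using () renaming (_≟_ to _≟ᶠ_)
open import Data.Fin.Subset using (Subset; ∣_∣; inside; outside)
open import Data.Vec using (Vec; []; _∷_)
open import Data.List.Base using (filterᵇ) renaming (allFin to allFinL)
open import Data.Product using (Σ; ∃; _×_; _,_)
open import Data.Integer using (+_)
open import Data.Rational using (ℚ; _*_; _≤_; _/_)
open import Relation.Binary.PropositionalEquality using (_≡_)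
open import Relation.Nullary using (¬_; does)

-- Generic finite "cochain data": a finite list of cells, each with a
-- dimension, and Z₂ incidence numbers  inc σ τ  (= [σ : τ] mod 2,
-- only meaningful when dim σ = dim τ + 1).  The list `cells` lists every
-- cell exactly once.  k-cochains are functions Cell → Bool (ℤ₂-valued);
-- only their values on k-cells matter.

record CochainData : Set₁ where
  field
    Cell  : Set
    cells : List Cell
    dim   : Cell → ℕ
    inc   : Cell → Cell → Bool

module _ (D : CochainData) where
  open CochainData D

  kcells : ℕ → List Cell
  kcells k = filterᵇ (λ σ → does (Data.Nat._≟_ (dim σ) k)) cells

  Cochain : Set
  Cochain = Cell → Bool

  parity : List Bool → Bool
  parity = foldr _xor_ false

  norm : ℕ → Cochain → ℕ
  norm k φ = length (filterᵇ (λ σ → φ σ) (kcells k))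

  cob : ℕ → Cochain → Cochain
  cob k φ σ = parity (map (λ τ → inc σ τ ∧ φ τ) (kcells k))

  _⊕_ : Cochain → Cochain → Cochain
  (φ ⊕ ψ) σ = φ σ xor ψ σ

  EqOn : ℕ → Cochain → Cochain → Set
  EqOn k φ ψ = All (λ σ → φ σ ≡ ψ σ) (kcells k)

  -- φ ∈ B^k = d_{k-1} C^{k-1}   (C^{-1} = 0, so B^0 = 0)
  IsCoboundary : ℕ → Cochain → Set
  IsCoboundary zero    φ = EqOn zero φ (λ _ → false)
  IsCoboundary (suc j) φ = ∃ λ (ψ : Cochain) → EqOn (suc j) φ (cob j ψ)

  -- m = ‖φ‖_csy = min_{ψ ∈ C^{k-1}} ‖φ + d_{k-1} ψ‖  (the min is attained)
  IsCsyNorm : ℕ → Cochain → ℕ → Set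
  IsCsyNorm zero    φ m = norm zero φ ≡ m
  IsCsyNorm (suc j) φ m =
    (∃ λ (ψ : Cochain) → norm (suc j) (φ ⊕ cob j ψ) ≡ m)
    × (∀ (ψ : Cochain) → m Data.Nat.≤ norm (suc j) (φ ⊕ cob j ψ))

  -- "h^k ≥ c":  ‖d_k φ‖ ≥ c · ‖φ‖_csy for every φ ∈ C^k ∖ B^k
  -- (with the convention h^k = ∞ when C^k = B^k)
  ExpAtLeast : ℕ → ℚ → Set
  ExpAtLeast k c = ∀ (φ : Cochain) → ¬ IsCoboundary k φ → ∀ (m : ℕ) → IsCsyNorm k φ m →
    c * ((+ m) / 1) Data.Rational.≤ ((+ norm (suc k) (cob k φ)) / 1)

-- A finite cell complex: N cells indexed by Fin N, with dimensions and
-- Z₂ incidence numbers satisfying ∂∘∂ = 0 and ε∘∂ = 0 (each 1-cell has an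
-- even number of boundary vertices, counted mod 2).

record CellComplex : Set where
  field
    N     : ℕ
    dim   : Fin N → ℕ
    inc   : Fin N → Fin N → Bool
    inc-dim : ∀ σ τ → inc σ τ ≡ true → dim σ ≡ suc (dim τ)
    ∂∂≡0  : ∀ σ τ → foldr _xor_ false (map (λ ρ → inc σ ρ ∧ inc ρ τ) (allFinL N)) ≡ false
    ε∂≡0  : ∀ e → dim e ≡ 1 → foldr _xor_ false (map (inc e) (allFinL N)) ≡ false

  toData : CochainData
  toData = record { Cell = Fin N ; cells = allFinL N ; dim = dim ; inc = inc }

-- The simplex Δ_{n-1} on vertex set [n]: simplices = nonempty subsets of
-- Fin n, dim β = |β| - 1; β' is a facet of β iff β' ⊆ β and |β| = |β'| + 1.

allSubsets : (n : ℕ) → List (Subset n)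
allSubsets zero    = [] ∷ []
allSubsets (suc n) = map (inside ∷_) (allSubsets n) ++ map (outside ∷_) (allSubsets n)

nonempty : ∀ {n} → Subset n → Bool
nonempty β = not (∣ β ∣ ≡ᵇ 0)

subsetB : ∀ {n} → Subset n → Subset n → Bool   -- subsetB β' β = β' ⊆ β
subsetB []        []       = true
subsetB (x ∷ xs) (y ∷ ys) = (not x ∨ y) ∧ subsetB xs ys

eqSubset : ∀ {n} → Subset n → Subset n → Bool
eqSubset β β' = subsetB β β' ∧ subsetB β' β

facetΔ : ∀ {n} → Subset n → Subset n → Bool   -- facetΔ β β' : β' is a facet of β
facetΔ β β' = subsetB β' β ∧ (∣ β ∣ ≡ᵇ suc ∣ β' ∣)

-- Product cell complex X × Δ_{n-1}: cells α × β, dim = dim α + dim β,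
-- ∂(α × β) = ∂α × β + α × ∂β  (mod 2).

_×Δ_ : CellComplex → ℕ → CochainData
X ×Δ n = record
  { Cell  = Fin N × Subset n
  ; cells = concatMap (λ α → map (α ,_) (filterᵇ nonempty (allSubsets n))) (allFinL N)
  ; dim   = λ { (α , β) → dim α + (∣ β ∣ ∸ 1) }
  ; inc   = λ { (α , β) (α' , β') →
               ((does (α ≟ᶠ α')) ∧ facetΔ β β') ∨ (eqSubset β β' ∧ inc α α') }
  }
  where open CellComplex X

module Submission where

open import Defs

-- Let φ be a k-cochain of X × Δ_{n-1} with cosystolic norm m.  For a vertex
-- v of the simplex, the cone operator cone_v (sending a face β to β ∪ {v})
-- satisfies the homotopy formula  φ + d(cone_v φ) = cone_v(dφ) + pr*(φ_v),
-- where φ_v is the restriction of φ to X × {v} and pr* places a cochain of X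
-- on all n copies X × {w}.  Correcting φ_v by a cosystolic minimiser χ gives
--   m ≤ ‖cone_v dφ‖ + n·m_v  and  c·m_v ≤ ‖d φ_v‖ = ‖dφ on X × {v}‖,
-- where m_v = ‖φ_v‖_csy and c is the bound h^k(X) ≥ c.  Split ‖dφ‖ = H + B,
-- with B the mass of dφ on the copies X × {v}; then ‖cone_v dφ‖ ≤ H and
-- Σ_v ‖cone_v dφ‖ ≤ (k+2)·H, since a (k+1)-cell α × γ has |γ| ≤ k+2.
-- Summing over the n vertices yields m ≤ H + S, n·m ≤ (k+2)·H + n·S and
-- c·S ≤ B for S = Σ_v m_v, and an elementary inequality in ℚ concludes.

module RationalInequality where
  open import Data.Nat as ℕ using (ℕ; zero; suc)
  import Data.Nat.Properties as ℕₚ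
  open import Data.Integer as ℤ using (+_)
  import Data.Integer.Properties as ℤₚ
  open import Data.Nat.Coprimality using (1-coprimeTo) renaming (sym to coprime-sym)
  open import Data.Rational
  open import Data.Rational.Properties
  open import Data.Rational.Solver using (module +-*-Solver)
  import Data.Rational.Unnormalised as ℚᵘ
  import Data.Rational.Unnormalised.Properties as ℚᵘₚ
  open import Data.Sum using (_⊎_; inj₁; inj₂)
  open import Relation.Binary.PropositionalEquality using (_≡_; refl; cong; cong₂; subst₂) renaming (sym to ≡-sym; trans to ≡-trans)

  ι : ℕ → ℚ
  ι a = (+ a) / 1

  ι-normal : ∀ a → ι a ≡ mkℚ (+ a) 0 (coprime-sym (1-coprimeTo a))
  ι-normal a = normalize-coprime (coprime-sym (1-coprimeTo a))

  ι-mono : ∀ {a b} → a ℕ.≤ b → ι a ≤ ι b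
  ι-mono {a} {b} a≤b rewrite ι-normal a | ι-normal b = *≤* (ℤₚ.*-monoʳ-≤-nonNeg (+ 1) (ℤ.+≤+ a≤b))

  ι-+ : ∀ a b → ι (a ℕ.+ b) ≡ ι a + ι b
  ι-+ a b rewrite ι-normal a | ι-normal b = /-cong numerators refl
    where
    numerators : + (a ℕ.+ b) ≡ (+ a ℤ.* + 1) ℤ.+ (+ b ℤ.* + 1)
    numerators rewrite ℤₚ.*-identityʳ (+ a) | ℤₚ.*-identityʳ (+ b) = ℤₚ.pos-+ a b

  ι-* : ∀ a b → ι (a ℕ.* b) ≡ ι a * ι b
  ι-* a b rewrite ι-normal a | ι-normal b = /-cong (ℤₚ.pos-* a b) refl

  ι-nonNeg : ∀ a → NonNegative (ι a)
  ι-nonNeg a = nonNegative (ι-mono {0} {a} ℕ.z≤n)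

  ι-pos : ∀ a → Positive (ι (suc a))
  ι-pos a = positive 0<ι
    where
    0<ι : ι 0 < ι (suc a)
    0<ι rewrite ι-normal 0 | ι-normal (suc a) =
      *<* (subst₂ ℤ._<_ (≡-sym (ℤₚ.*-identityʳ (+ 0))) (≡-sym (ℤₚ.*-identityʳ (+ suc a))) (ℤ.+<+ (ℕ.s≤s ℕ.z≤n)))

  /-*-cancel : ∀ n d-1 → ((+ n) / suc d-1) * ι (suc d-1) ≡ ι n
  /-*-cancel n d-1 = toℚᵘ-injective
    (ℚᵘₚ.≃-trans (toℚᵘ-homo-* ((+ n) / suc d-1) (ι (suc d-1)))
    (ℚᵘₚ.≃-trans (ℚᵘₚ.*-cong (toℚᵘ-fromℚᵘ (ℚᵘ.mkℚᵘ (+ n) d-1)) (toℚᵘ-fromℚᵘ (ℚᵘ.mkℚᵘ (+ suc d-1) 0)))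
    (ℚᵘₚ.≃-trans (ℚᵘ.*≡* cross) (ℚᵘₚ.≃-sym (toℚᵘ-fromℚᵘ (ℚᵘ.mkℚᵘ (+ n) 0))))))
    where
    cross : (+ n ℤ.* + suc d-1) ℤ.* + 1 ≡ + n ℤ.* + (suc d-1 ℕ.* 1)
    cross = ≡-trans (ℤₚ.*-identityʳ _) (cong (λ z → + n ℤ.* + z) (≡-sym (ℕₚ.*-identityʳ (suc d-1))))

  weighted-bound : ∀ (c c' : ℚ) w-1 w' m H S B → 0ℚ ≤ c' → c' ≤ c → c' * ι w' ≤ ι (suc w-1) →
    suc w-1 ℕ.* m ℕ.≤ w' ℕ.* H ℕ.+ suc w-1 ℕ.* S → c * ι S ≤ ι B → c' * ι m ≤ ι (H ℕ.+ B)
  weighted-bound c c' w-1 w' m H S B 0≤c' c'≤c c'w'≤w counting cS≤B =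
    *-cancelˡ-≤-pos (ι w) {{ι-pos w-1}} (begin
      ι w * (c' * ι m)                          ≡⟨ solve 3 (λ W C M → W :* (C :* M) := C :* (W :* M)) refl (ι w) c' (ι m) ⟩
      c' * (ι w * ι m)                          ≡⟨ cong (c' *_) (≡-sym (ι-* w m)) ⟩
      c' * ι (w ℕ.* m)                          ≤⟨ *-monoˡ-≤-nonNeg c' {{nonNegative 0≤c'}} (ι-mono counting) ⟩
      c' * ι (w' ℕ.* H ℕ.+ w ℕ.* S)             ≡⟨ cong (c' *_) (≡-trans (ι-+ (w' ℕ.* H) (w ℕ.* S)) (cong₂ _+_ (ι-* w' H) (ι-* w S))) ⟩
      c' * (ι w' * ι H + ι w * ι S)             ≡⟨ solve 5 (λ C W' H W S → C :* (W' :* H :+ W :* S) := (C :* W') :* H :+ W :* (C :* S)) refl c' (ι w') (ι H) (ι w) (ι S) ⟩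
      (c' * ι w') * ι H + ι w * (c' * ι S)      ≤⟨ +-mono-≤ (*-monoʳ-≤-nonNeg (ι H) {{ι-nonNeg H}} c'w'≤w)
                                                            (*-monoˡ-≤-nonNeg (ι w) {{ι-nonNeg w}} c'S≤B) ⟩
      ι w * ι H + ι w * ι B                     ≡⟨ ≡-sym (≡-trans (cong (ι w *_) (ι-+ H B)) (*-distribˡ-+ (ι w) (ι H) (ι B))) ⟩
      ι w * ι (H ℕ.+ B)                         ∎)
    where
    open ≤-Reasoning
    open +-*-Solver
    w : ℕ
    w = suc w-1
    c'S≤B : c' * ι S ≤ ι B
    c'S≤B = ≤-trans (*-monoʳ-≤-nonNeg (ι S) {{ι-nonNeg S}} c'≤c) cS≤B

  min-max-bound : ∀ (c : ℚ) n-1 k m H S B → m ℕ.≤ H ℕ.+ S →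
    suc n-1 ℕ.* m ℕ.≤ suc (suc k) ℕ.* H ℕ.+ suc n-1 ℕ.* S → c * ι S ≤ ι B →
    (c ⊓ (1ℚ ⊔ ((+ suc n-1) / suc (suc k)))) * ι m ≤ ι (H ℕ.+ B)
  min-max-bound c n-1 k m H S B m≤H+S nm≤ cS≤B = by-cases (≤-total 0ℚ c') (⊔-sel 1ℚ x)
    where
    x : ℚ
    x = (+ suc n-1) / suc (suc k)
    c' : ℚ
    c' = c ⊓ (1ℚ ⊔ x)
    c'≤c : c' ≤ c
    c'≤c = p⊓q≤p c (1ℚ ⊔ x)
    c'≤max : ∀ {t} → 1ℚ ⊔ x ≡ t → c' ≤ t
    c'≤max refl = p⊓q≤q c (1ℚ ⊔ x)
    by-cases : 0ℚ ≤ c' ⊎ c' ≤ 0ℚ → 1ℚ ⊔ x ≡ 1ℚ ⊎ 1ℚ ⊔ x ≡ x → c' * ι m ≤ ι (H ℕ.+ B)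
    by-cases (inj₂ c'≤0) _ =
      ≤-trans (*-monoʳ-≤-nonNeg (ι m) {{ι-nonNeg m}} c'≤0) (≤-trans (≤-reflexive (*-zeroˡ (ι m))) (ι-mono {0} {H ℕ.+ B} ℕ.z≤n))
    by-cases (inj₁ 0≤c') (inj₁ max≡1) =
      weighted-bound c c' 0 1 m H S B 0≤c' c'≤c
        (≤-trans (*-monoʳ-≤-nonNeg (ι 1) {{ι-nonNeg 1}} (c'≤max max≡1)) (≤-reflexive (*-identityˡ (ι 1))))
        (subst₂ ℕ._≤_ (≡-sym (ℕₚ.*-identityˡ m)) (≡-sym (cong₂ ℕ._+_ (ℕₚ.*-identityˡ H) (ℕₚ.*-identityˡ S))) m≤H+S)
        cS≤B
    by-cases (inj₁ 0≤c') (inj₂ max≡x) =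
      weighted-bound c c' n-1 (suc (suc k)) m H S B 0≤c' c'≤c
        (≤-trans (*-monoʳ-≤-nonNeg (ι (suc (suc k))) {{ι-nonNeg (suc (suc k))}} (c'≤max max≡x))
                 (≤-reflexive (/-*-cancel (suc n-1) (suc k))))
        nm≤ cS≤B

open RationalInequality using (ι; ι-mono; ι-+; min-max-bound)

open import Algebra.Properties.CommutativeSemigroup using (interchange)
open import Data.Bool using (Bool; true; false; _∧_; _∨_; _xor_; not; T)
open import Data.Bool.Properties using (T-∧; T-≡; xor-assoc; xor-same; xor-identityʳ; ∧-zeroʳ; ∧-distribˡ-xor)
open import Data.Empty using (⊥-elim)
open import Data.Fin using (Fin; zero; suc)
open import Data.Fin.Properties using () renaming (_≟_ to _≟ᶠ_)
open import Data.Fin.Subset using (Subset; ∣_∣)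
open import Data.List using (List; []; _∷_; map; length; concatMap; _++_; foldr; filterᵇ)
open import Data.List.Base using (allFin; tabulate)
open import Data.List.Extrema.Nat using (argmin; f[argmin]≤f[xs])
open import Data.List.Membership.Propositional using (_∈_)
open import Data.List.Membership.Propositional.Properties using (∈-map⁺; ∈-++⁺ˡ; ∈-++⁺ʳ)
open import Data.List.Properties using (length-tabulate)
open import Data.List.Relation.Unary.All as All using (All; []; _∷_)
open import Data.List.Relation.Unary.Any using (here)
open import Data.Nat using (ℕ; NonZero; zero; suc; _+_; _*_; _∸_; _≤_; _≡ᵇ_; z≤n; s≤s)
open import Data.Nat.Properties
  using (*-cancelˡ-≤; *-comm; *-distribˡ-+; *-monoˡ-≤; *-zeroʳ; +-assoc; +-commutativeSemigroup; +-identityʳ;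
         +-mono-≤; +-monoˡ-≤; +-suc; 1+n≢0; 1+n≢n; m≤n+m; m≤n⇒m≤1+n; suc-injective; ≡ᵇ⇒≡; ≡⇒≡ᵇ;
         module ≤-Reasoning; ≤-refl; ≤-reflexive; ≤-trans)
open import Data.Product using (Σ; _×_; _,_; proj₁; proj₂)
import Data.Rational as ℚ
import Data.Rational.Properties as ℚₚ
open import Data.Sum using (_⊎_; inj₁; inj₂)
import Data.Vec as Vec
open import Data.Vec using ([]; _∷_)
open import Data.Vec.Properties using (lookup∘tabulate)
open import Function.Bundles using (Equivalence)
open import Relation.Binary.PropositionalEquality
open import Relation.Nullary using (¬_; does; yes; no)

private variable A C : Set

-- Boolean identities.  Identities in k variables are decided by
-- evaluating both sides at all 2^k points; `decide` turns a successful
-- evaluation into a proof of the identity.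

BoolFun : ℕ → Set
BoolFun zero    = Bool
BoolFun (suc k) = Bool → BoolFun k

_≐_ : ∀ {k} → BoolFun k → BoolFun k → Bool
_≐_ {zero}  a b = not (a xor b)
_≐_ {suc k} f g = (f true ≐ g true) ∧ (f false ≐ g false)

Pointwise : ∀ k → BoolFun k → BoolFun k → Set
Pointwise zero    a b = a ≡ b
Pointwise (suc k) f g = ∀ x → Pointwise k (f x) (g x)

decide : ∀ k {f g : BoolFun k} → T (f ≐ g) → Pointwise k f g
decide zero    {true}  {true}  _ = refl
decide zero    {false} {false} _ = refl
decide (suc k) agree true  = decide k (proj₁ (Equivalence.to T-∧ agree))
decide (suc k) agree false = decide k (proj₂ (Equivalence.to T-∧ agree))

xor-interchange : ∀ a b c d → (a xor b) xor (c xor d) ≡ (a xor c) xor (b xor d)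
xor-interchange = decide 4 _

xor-vanishˡ : ∀ {a b} → a ≡ false → a xor b ≡ b
xor-vanishˡ refl = refl

xor-vanishʳ : ∀ {a b} → b ≡ false → a xor b ≡ a
xor-vanishʳ {a} refl = xor-identityʳ a

≡ᵇ-sound : ∀ a b → (a ≡ᵇ b) ≡ true → a ≡ b
≡ᵇ-sound a b e = ≡ᵇ⇒≡ a b (subst T (sym e) _)

≡ᵇ-complete : ∀ {a b} → a ≡ b → (a ≡ᵇ b) ≡ true
≡ᵇ-complete {a} {b} e = Equivalence.to T-≡ (≡⇒≡ᵇ a b e)

-- a disjunction of two mutually exclusive incidences is their ℤ₂-sum
exclusive-∨ : ∀ a p q m i f → p ∧ q ≡ false → (q ≡ true → m ≡ true) →
  m ∧ (((a ∧ p) ∨ (q ∧ i)) ∧ f) ≡ (a ∧ (p ∧ (m ∧ f))) xor (q ∧ (i ∧ f))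
exclusive-∨ a true  true  m i f () _
exclusive-∨ a true  false m i f _ _ =
  decide 3 {λ a m f → m ∧ (((a ∧ true) ∨ false) ∧ f)} {λ a m f → (a ∧ (m ∧ f)) xor false} _ a m f
exclusive-∨ a false true  m i f _ q⇒m rewrite q⇒m refl =
  decide 3 {λ a i f → ((a ∧ false) ∨ i) ∧ f} {λ a i f → (a ∧ false) xor (i ∧ f)} _ a i f
exclusive-∨ a false false m i f _ _ =
  decide 3 {λ a m f → m ∧ (((a ∧ false) ∨ false) ∧ f)} {λ a m f → (a ∧ false) xor false} _ a m f

false≢true : false ≢ true
false≢true ()

∨-split : ∀ a b → a ∨ b ≡ true → a ≡ true ⊎ b ≡ true
∨-split true  b _ = inj₁ refl
∨-split false b e = inj₂ e

∧-left : ∀ {a b} → a ∧ b ≡ true → a ≡ true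
∧-left {true} _ = refl

∧-right : ∀ {a b} → a ∧ b ≡ true → b ≡ true
∧-right {true} e = e

sumℕ : List A → (A → ℕ) → ℕ
sumℕ []       f = 0
sumℕ (x ∷ xs) f = f x + sumℕ xs f

sum₂ : List A → (A → Bool) → Bool
sum₂ []       f = false
sum₂ (x ∷ xs) f = f x xor sum₂ xs f

_·_ : Bool → ℕ → ℕ
true  · x = x
false · x = 0

⟦_⟧ : Bool → ℕ
⟦ b ⟧ = b · 1

sumℕ-ext : (L : List A) {f g : A → ℕ} → (∀ x → f x ≡ g x) → sumℕ L f ≡ sumℕ L g
sumℕ-ext []      e = refl
sumℕ-ext (x ∷ L) e = cong₂ _+_ (e x) (sumℕ-ext L e)

sum₂-ext : (L : List A) {f g : A → Bool} → (∀ x → f x ≡ g x) → sum₂ L f ≡ sum₂ L g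
sum₂-ext []      e = refl
sum₂-ext (x ∷ L) e = cong₂ _xor_ (e x) (sum₂-ext L e)

sumℕ-++ : (L M : List A) (f : A → ℕ) → sumℕ (L ++ M) f ≡ sumℕ L f + sumℕ M f
sumℕ-++ []      M f = refl
sumℕ-++ (x ∷ L) M f = trans (cong (f x +_) (sumℕ-++ L M f)) (sym (+-assoc (f x) _ _))

sum₂-++ : (L M : List A) (f : A → Bool) → sum₂ (L ++ M) f ≡ sum₂ L f xor sum₂ M f
sum₂-++ []      M f = refl
sum₂-++ (x ∷ L) M f = trans (cong (f x xor_) (sum₂-++ L M f)) (sym (xor-assoc (f x) _ _))

sumℕ-map : (h : A → C) (L : List A) (f : C → ℕ) → sumℕ (map h L) f ≡ sumℕ L (λ x → f (h x))
sumℕ-map h []      f = refl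
sumℕ-map h (x ∷ L) f = cong (f (h x) +_) (sumℕ-map h L f)

sum₂-map : (h : A → C) (L : List A) (f : C → Bool) → sum₂ (map h L) f ≡ sum₂ L (λ x → f (h x))
sum₂-map h []      f = refl
sum₂-map h (x ∷ L) f = cong (f (h x) xor_) (sum₂-map h L f)

sumℕ-concatMap : (g : A → List C) (L : List A) (f : C → ℕ) →
  sumℕ (concatMap g L) f ≡ sumℕ L (λ x → sumℕ (g x) f)
sumℕ-concatMap g []      f = refl
sumℕ-concatMap g (x ∷ L) f =
  trans (sumℕ-++ (g x) (concatMap g L) f) (cong (sumℕ (g x) f +_) (sumℕ-concatMap g L f))

sum₂-concatMap : (g : A → List C) (L : List A) (f : C → Bool) →
  sum₂ (concatMap g L) f ≡ sum₂ L (λ x → sum₂ (g x) f)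
sum₂-concatMap g []      f = refl
sum₂-concatMap g (x ∷ L) f =
  trans (sum₂-++ (g x) (concatMap g L) f) (cong (sum₂ (g x) f xor_) (sum₂-concatMap g L f))

sumℕ-filter : (p : A → Bool) (L : List A) (f : A → ℕ) → sumℕ (filterᵇ p L) f ≡ sumℕ L (λ x → p x · f x)
sumℕ-filter p []      f = refl
sumℕ-filter p (x ∷ L) f with p x
... | true  = cong (f x +_) (sumℕ-filter p L f)
... | false = sumℕ-filter p L f

sum₂-filter : (p : A → Bool) (L : List A) (f : A → Bool) → sum₂ (filterᵇ p L) f ≡ sum₂ L (λ x → p x ∧ f x)
sum₂-filter p []      f = refl
sum₂-filter p (x ∷ L) f with p x
... | true  = cong (f x xor_) (sum₂-filter p L f)
... | false = sum₂-filter p L f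

length-filter : (p : A → Bool) (L : List A) → length (filterᵇ p L) ≡ sumℕ L (λ x → ⟦ p x ⟧)
length-filter p []      = refl
length-filter p (x ∷ L) with p x
... | true  = cong suc (length-filter p L)
... | false = length-filter p L

parity-map : (L : List A) (f : A → Bool) → foldr _xor_ false (map f L) ≡ sum₂ L f
parity-map []      f = refl
parity-map (x ∷ L) f = cong (f x xor_) (parity-map L f)

sumℕ-+ : (L : List A) (f g : A → ℕ) → sumℕ L (λ x → f x + g x) ≡ sumℕ L f + sumℕ L g
sumℕ-+ []      f g = refl
sumℕ-+ (x ∷ L) f g = trans (cong ((f x + g x) +_) (sumℕ-+ L f g))
                           (interchange +-commutativeSemigroup (f x) (g x) (sumℕ L f) (sumℕ L g))

sum₂-xor : (L : List A) (f g : A → Bool) → sum₂ L (λ x → f x xor g x) ≡ sum₂ L f xor sum₂ L g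
sum₂-xor []      f g = refl
sum₂-xor (x ∷ L) f g = trans (cong ((f x xor g x) xor_) (sum₂-xor L f g))
                             (xor-interchange (f x) (g x) (sum₂ L f) (sum₂ L g))

sum₂-zero : (L : List A) (f : A → Bool) → (∀ x → f x ≡ false) → sum₂ L f ≡ false
sum₂-zero []      f e = refl
sum₂-zero (x ∷ L) f e = trans (cong (_xor sum₂ L f) (e x)) (sum₂-zero L f e)

sum₂-∧ : (L : List A) (b : Bool) (f : A → Bool) → sum₂ L (λ x → b ∧ f x) ≡ b ∧ sum₂ L f
sum₂-∧ L true  f = refl
sum₂-∧ L false f = sum₂-zero L _ (λ _ → refl)

sumℕ-zero : (L : List A) (f : A → ℕ) → (∀ x → f x ≡ 0) → sumℕ L f ≡ 0
sumℕ-zero []      f e = refl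
sumℕ-zero (x ∷ L) f e = trans (cong (_+ sumℕ L f) (e x)) (sumℕ-zero L f e)

sumℕ-* : (L : List A) (a : ℕ) (f : A → ℕ) → sumℕ L (λ x → a * f x) ≡ a * sumℕ L f
sumℕ-* []      a f = sym (*-zeroʳ a)
sumℕ-* (x ∷ L) a f = trans (cong (a * f x +_) (sumℕ-* L a f)) (sym (*-distribˡ-+ a (f x) (sumℕ L f)))

sumℕ-const : (L : List A) (a : ℕ) → sumℕ L (λ _ → a) ≡ length L * a
sumℕ-const []      a = refl
sumℕ-const (x ∷ L) a = cong (a +_) (sumℕ-const L a)

sumℕ-mono : (L : List A) {f g : A → ℕ} → (∀ x → f x ≤ g x) → sumℕ L f ≤ sumℕ L g
sumℕ-mono []      e = z≤n
sumℕ-mono (x ∷ L) e = +-mono-≤ (e x) (sumℕ-mono L e)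

sumℕ-swap : (L : List A) (M : List C) (f : A → C → ℕ) →
  sumℕ L (λ x → sumℕ M (f x)) ≡ sumℕ M (λ y → sumℕ L (λ x → f x y))
sumℕ-swap []      M f = sym (sumℕ-zero M _ (λ _ → refl))
sumℕ-swap (x ∷ L) M f =
  trans (cong (sumℕ M (f x) +_) (sumℕ-swap L M f)) (sym (sumℕ-+ M (f x) (λ y → sumℕ L (λ x → f x y))))

sumℕ-tabulate : ∀ {N} (g : Fin N → A) (f : A → ℕ) → sumℕ (tabulate g) f ≡ sumℕ (allFin N) (λ i → f (g i))
sumℕ-tabulate {N = zero}  g f = refl
sumℕ-tabulate {N = suc N} g f =
  cong (f (g zero) +_) (trans (sumℕ-tabulate (λ i → g (suc i)) f) (sym (sumℕ-tabulate suc (λ i → f (g i)))))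

sum₂-tabulate : ∀ {N} (g : Fin N → A) (f : A → Bool) → sum₂ (tabulate g) f ≡ sum₂ (allFin N) (λ i → f (g i))
sum₂-tabulate {N = zero}  g f = refl
sum₂-tabulate {N = suc N} g f =
  cong (f (g zero) xor_) (trans (sum₂-tabulate (λ i → g (suc i)) f) (sym (sum₂-tabulate suc (λ i → f (g i)))))

sumℕ-allFin-suc : ∀ N (f : Fin (suc N) → ℕ) → sumℕ (allFin (suc N)) f ≡ f zero + sumℕ (allFin N) (λ i → f (suc i))
sumℕ-allFin-suc N f = cong (f zero +_) (sumℕ-tabulate suc f)

sum₂-allFin-suc : ∀ N (f : Fin (suc N) → Bool) → sum₂ (allFin (suc N)) f ≡ f zero xor sum₂ (allFin N) (λ i → f (suc i))
sum₂-allFin-suc N f = cong (f zero xor_) (sum₂-tabulate suc f)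

sum₂-false : (L : List A) → sum₂ L (λ _ → false) ≡ false
sum₂-false L = sum₂-zero L (λ _ → false) (λ _ → refl)

sumℕ-0 : (L : List A) → sumℕ L (λ _ → 0) ≡ 0
sumℕ-0 L = sumℕ-zero L (λ _ → 0) (λ _ → refl)

sum₂-delta : ∀ N (a : Fin N) (g : Fin N → Bool) → sum₂ (allFin N) (λ a' → does (a ≟ᶠ a') ∧ g a') ≡ g a
sum₂-delta (suc N) zero g =
  trans (sum₂-allFin-suc N (λ a' → does (zero ≟ᶠ a') ∧ g a')) (xor-vanishʳ (sum₂-false (allFin N)))
sum₂-delta (suc N) (suc a) g =
  trans (sum₂-allFin-suc N (λ a' → does (suc a ≟ᶠ a') ∧ g a')) (trans (sum₂-ext (allFin N) delta-suc) (sum₂-delta N a (λ a' → g (suc a'))))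
  where
  delta-suc : ∀ a' → does (suc a ≟ᶠ suc a') ∧ g (suc a') ≡ does (a ≟ᶠ a') ∧ g (suc a')
  delta-suc a' with a ≟ᶠ a'
  ... | yes _ = refl
  ... | no  _ = refl

+-vanishˡ : ∀ {a b} → a ≡ 0 → a + b ≡ b
+-vanishˡ refl = refl

+-vanishʳ : ∀ {a b} → b ≡ 0 → a + b ≡ a
+-vanishʳ {a} refl = +-identityʳ a

·-≤ : ∀ b x → b · x ≤ x
·-≤ true  x = ≤-refl
·-≤ false x = z≤n

·-zero : ∀ b → b · 0 ≡ 0
·-zero true  = refl
·-zero false = refl

·-as-* : ∀ b x → b · x ≡ ⟦ b ⟧ * x
·-as-* true  x = sym (+-identityʳ x)
·-as-* false x = refl

filter-nothing : (p : A → Bool) (L : List A) → All (λ x → p x ≡ false) L → length (filterᵇ p L) ≡ 0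
filter-nothing p []      []          = refl
filter-nothing p (x ∷ L) (px ∷ all) rewrite px = filter-nothing p L all

xor-bit : ∀ a b → ⟦ a xor b ⟧ ≤ ⟦ a ⟧ + ⟦ b ⟧
xor-bit true  true  = z≤n
xor-bit true  false = s≤s z≤n
xor-bit false b     = ≤-reflexive refl

module CochainFacts (D : CochainData) where
  open CochainData D

  norm-as-sum : ∀ k φ → norm D k φ ≡ sumℕ cells (λ σ → (dim σ ≡ᵇ k) · ⟦ φ σ ⟧)
  norm-as-sum k φ = trans (length-filter φ (kcells D k)) (sumℕ-filter (λ σ → dim σ ≡ᵇ k) cells (λ σ → ⟦ φ σ ⟧))

  cob-as-sum : ∀ k φ σ → cob D k φ σ ≡ sum₂ cells (λ τ → (dim τ ≡ᵇ k) ∧ (inc σ τ ∧ φ τ))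
  cob-as-sum k φ σ = trans (parity-map (kcells D k) (λ τ → inc σ τ ∧ φ τ)) (sum₂-filter (λ σ → dim σ ≡ᵇ k) cells _)

  norm-ext : ∀ k φ ψ → (∀ σ → dim σ ≡ k → φ σ ≡ ψ σ) → norm D k φ ≡ norm D k ψ
  norm-ext k φ ψ agree = trans (norm-as-sum k φ) (trans (sumℕ-ext cells on-cell) (sym (norm-as-sum k ψ)))
    where
    on-cell : ∀ σ → (dim σ ≡ᵇ k) · ⟦ φ σ ⟧ ≡ (dim σ ≡ᵇ k) · ⟦ ψ σ ⟧
    on-cell σ with dim σ ≡ᵇ k in is-k
    ... | false = refl
    ... | true  = cong ⟦_⟧ (agree σ (≡ᵇ-sound _ _ is-k))

  norm-⊕ : ∀ k φ ψ → norm D k (_⊕_ D φ ψ) ≤ norm D k φ + norm D k ψ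
  norm-⊕ k φ ψ rewrite norm-as-sum k (_⊕_ D φ ψ) | norm-as-sum k φ | norm-as-sum k ψ =
    ≤-trans (sumℕ-mono cells on-cell) (≤-reflexive (sumℕ-+ cells _ _))
    where
    on-cell : ∀ σ → (dim σ ≡ᵇ k) · ⟦ φ σ xor ψ σ ⟧ ≤ (dim σ ≡ᵇ k) · ⟦ φ σ ⟧ + (dim σ ≡ᵇ k) · ⟦ ψ σ ⟧
    on-cell σ with dim σ ≡ᵇ k
    ... | false = z≤n
    ... | true  = xor-bit (φ σ) (ψ σ)

  cob-ext : ∀ k φ ψ → (∀ τ → φ τ ≡ ψ τ) → ∀ σ → cob D k φ σ ≡ cob D k ψ σ
  cob-ext k φ ψ agree σ =
    trans (cob-as-sum k φ σ)
          (trans (sum₂-ext cells (λ τ → cong (λ b → (dim τ ≡ᵇ k) ∧ (inc σ τ ∧ b)) (agree τ))) (sym (cob-as-sum k ψ σ)))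

  -- A lower bound h^k ≥ c bounds ‖d_k ψ‖ for every k-cochain, coboundaries
  -- included: a coboundary has cosystolic norm 0.
  expansion-bound : ∀ {k c} → ExpAtLeast D k c → ∀ ψ m → IsCsyNorm D k ψ m →
    c ℚ.* ι m ℚ.≤ ι (norm D (suc k) (cob D k ψ))
  expansion-bound {k} {c} hyp ψ zero _ =
    ℚₚ.≤-trans (ℚₚ.≤-reflexive (ℚₚ.*-zeroʳ c)) (ι-mono {0} {norm D (suc k) (cob D k ψ)} z≤n)
  expansion-bound {zero} hyp ψ (suc t) norm≡ = hyp ψ not-coboundary (suc t) norm≡
    where
    not-coboundary : ¬ IsCoboundary D zero ψ
    not-coboundary vanishes with trans (sym norm≡) (filter-nothing ψ (kcells D 0) vanishes)
    ... | ()
  expansion-bound {suc j} hyp ψ (suc t) csy = hyp ψ not-coboundary (suc t) csy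
    where
    not-coboundary : ¬ IsCoboundary D (suc j) ψ
    not-coboundary (χ , ψ≡dχ) with ≤-trans (proj₂ csy χ) (≤-reflexive
      (filter-nothing _ (kcells D (suc j)) (All.map (λ {σ} e → trans (cong (_xor cob D j χ σ) e) (xor-same (cob D j χ σ))) ψ≡dχ)))
    ... | ()

∈-allSubsets : ∀ {n} (β : Subset n) → β ∈ allSubsets n
∈-allSubsets []          = here refl
∈-allSubsets (true ∷ β)  = ∈-++⁺ˡ (∈-map⁺ (true ∷_) (∈-allSubsets β))
∈-allSubsets (false ∷ β) = ∈-++⁺ʳ _ (∈-map⁺ (false ∷_) (∈-allSubsets β))

module CosystolicMinimum (X : CellComplex) where
  open CellComplex X

  minimiser : ∀ j (ψ : Fin N → Bool) → Σ (Fin N → Bool) λ χ → ∀ χ' →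
    norm toData (suc j) (_⊕_ toData ψ (cob toData j χ)) ≤ norm toData (suc j) (_⊕_ toData ψ (cob toData j χ'))
  minimiser j ψ = χ₀ , bound
    where
    weight : (Fin N → Bool) → ℕ
    weight χ = norm toData (suc j) (_⊕_ toData ψ (cob toData j χ))
    candidates : List (Fin N → Bool)
    candidates = map Vec.lookup (allSubsets N)
    χ₀ : Fin N → Bool
    χ₀ = argmin weight (λ _ → false) candidates
    bound : ∀ χ' → weight χ₀ ≤ weight χ'
    bound χ' = ≤-trans
      (All.lookup (f[argmin]≤f[xs] {f = weight} (λ _ → false) candidates) (∈-map⁺ Vec.lookup (∈-allSubsets (Vec.tabulate χ'))))
      (≤-reflexive (CochainFacts.norm-ext toData (suc j) _ _ λ σ _ →
        cong (ψ σ xor_) (CochainFacts.cob-ext toData j _ _ (lookup∘tabulate χ') σ)))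

sumℕ-subsets : ∀ n (f : Subset (suc n) → ℕ) →
  sumℕ (allSubsets (suc n)) f ≡ sumℕ (allSubsets n) (λ β → f (true ∷ β)) + sumℕ (allSubsets n) (λ β → f (false ∷ β))
sumℕ-subsets n f = trans (sumℕ-++ (map (true ∷_) (allSubsets n)) _ f)
                         (cong₂ _+_ (sumℕ-map (true ∷_) (allSubsets n) f) (sumℕ-map (false ∷_) (allSubsets n) f))

sum₂-subsets : ∀ n (f : Subset (suc n) → Bool) →
  sum₂ (allSubsets (suc n)) f ≡ sum₂ (allSubsets n) (λ β → f (true ∷ β)) xor sum₂ (allSubsets n) (λ β → f (false ∷ β))
sum₂-subsets n f = trans (sum₂-++ (map (true ∷_) (allSubsets n)) _ f)
                         (cong₂ _xor_ (sum₂-map (true ∷_) (allSubsets n) f) (sum₂-map (false ∷_) (allSubsets n) f))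

_∈ᵇ_ : ∀ {n} → Fin n → Subset n → Bool
zero  ∈ᵇ (x ∷ β) = x
suc v ∈ᵇ (x ∷ β) = v ∈ᵇ β

insert : ∀ {n} → Fin n → Subset n → Subset n
insert zero    (x ∷ β) = true ∷ β
insert (suc v) (x ∷ β) = x ∷ insert v β

∅ : ∀ n → Subset n
∅ zero    = []
∅ (suc n) = false ∷ ∅ n

-- parity of a natural number (a face β has |β| facets)
odd : ℕ → Bool
odd zero    = false
odd (suc n) = not (odd n)

-- The coboundary of the augmented simplex (the empty face included):
-- (δ h)(β) = Σ_{β' facet of β} h(β').
δ : ∀ {n} → (Subset n → Bool) → Subset n → Bool
δ {n} h β = sum₂ (allSubsets n) (λ β' → facetΔ β β' ∧ h β')

cone : ∀ {n} → Fin n → (Subset n → Bool) → Subset n → Bool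
cone v g β = not (v ∈ᵇ β) ∧ g (insert v β)

insert-size : ∀ {n} (v : Fin n) (β : Subset n) → v ∈ᵇ β ≡ false → ∣ insert v β ∣ ≡ suc ∣ β ∣
insert-size zero    (false ∷ β) _   = refl
insert-size (suc v) (true ∷ β)  v∉β = cong suc (insert-size v β v∉β)
insert-size (suc v) (false ∷ β) v∉β = insert-size v β v∉β

size-zero : ∀ {n} (β : Subset n) → ∣ β ∣ ≡ 0 → β ≡ ∅ n
size-zero []          _ = refl
size-zero (false ∷ β) e = cong (false ∷_) (size-zero β e)

∉∅ : ∀ {n} (v : Fin n) → v ∈ᵇ ∅ n ≡ false
∉∅ zero    = refl
∉∅ (suc v) = ∉∅ v

∅-size : ∀ n → ∣ ∅ n ∣ ≡ 0
∅-size zero    = refl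
∅-size (suc n) = ∅-size n

eqSubset-sound : ∀ {n} (β β' : Subset n) → eqSubset β β' ≡ true → β ≡ β'
eqSubset-sound []         []          _ = refl
eqSubset-sound (true ∷ β) (true ∷ β') e = cong (true ∷_) (eqSubset-sound β β' e)
eqSubset-sound (false ∷ β) (false ∷ β') e = cong (false ∷_) (eqSubset-sound β β' e)
eqSubset-sound (false ∷ β) (true ∷ β') e with subsetB β β'
eqSubset-sound (false ∷ β) (true ∷ β') () | true
eqSubset-sound (false ∷ β) (true ∷ β') () | false

facet-size : ∀ {n} (β β' : Subset n) → facetΔ β β' ≡ true → ∣ β ∣ ≡ suc ∣ β' ∣
facet-size β β' e with subsetB β' β | ∣ β ∣ ≡ᵇ suc ∣ β' ∣ in sizes
... | true | true = ≡ᵇ-sound _ _ sizes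

vertex : ∀ {n} → Fin n → Subset n
vertex {n} v = insert v (∅ n)

vertex-size : ∀ {n} (v : Fin n) → ∣ vertex v ∣ ≡ 1
vertex-size {n} v = trans (insert-size v (∅ n) (∉∅ v)) (cong suc (∅-size n))

nonempty-insert : ∀ {n} (v : Fin n) β → v ∈ᵇ β ≡ false → nonempty (insert v β) ≡ true
nonempty-insert v β v∉β rewrite insert-size v β v∉β = refl

nonempty-size : ∀ {n} (β : Subset n) → nonempty β ≡ true → Σ ℕ (λ t → ∣ β ∣ ≡ suc t)
nonempty-size β _ with ∣ β ∣
... | suc t = t , refl

⊆-size : ∀ {n} (β' β : Subset n) → subsetB β' β ≡ true → ∣ β' ∣ ≤ ∣ β ∣
⊆-size []          []         _ = z≤n
⊆-size (true ∷ β') (true ∷ β) s = s≤s (⊆-size β' β s)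
⊆-size (false ∷ β') (true ∷ β) s = m≤n⇒m≤1+n (⊆-size β' β s)
⊆-size (false ∷ β') (false ∷ β) s = ⊆-size β' β s

suc≢ᵇ : ∀ a b → a ≤ b → (suc b ≡ᵇ a) ≡ false
suc≢ᵇ zero    b       _         = refl
suc≢ᵇ (suc a) (suc b) (s≤s a≤b) = suc≢ᵇ a b a≤b

sum-same-size-subsets : ∀ n (β : Subset n) (h : Subset n → Bool) →
  sum₂ (allSubsets n) (λ β' → (subsetB β' β ∧ (∣ β ∣ ≡ᵇ ∣ β' ∣)) ∧ h β') ≡ h β
sum-same-size-subsets zero [] h = xor-identityʳ (h [])
sum-same-size-subsets (suc n) (true ∷ β) h =
  trans (sum₂-subsets n _)
        (trans (xor-vanishʳ (sum₂-zero (allSubsets n) _ too-small)) (sum-same-size-subsets n β (λ β' → h (true ∷ β'))))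
  where
  too-small : ∀ β' → (subsetB β' β ∧ (suc ∣ β ∣ ≡ᵇ ∣ β' ∣)) ∧ h (false ∷ β') ≡ false
  too-small β' with subsetB β' β in β'⊆β
  ... | false = refl
  ... | true rewrite suc≢ᵇ ∣ β' ∣ ∣ β ∣ (⊆-size β' β β'⊆β) = refl
sum-same-size-subsets (suc n) (false ∷ β) h =
  trans (sum₂-subsets n _) (trans (xor-vanishˡ (sum₂-false (allSubsets n))) (sum-same-size-subsets n β (λ β' → h (false ∷ β'))))

sum-equal-subsets : ∀ {n} (β : Subset n) (h : Subset n → Bool) → sum₂ (allSubsets n) (λ β' → eqSubset β β' ∧ h β') ≡ h β
sum-equal-subsets []          h = xor-identityʳ (h [])
sum-equal-subsets {suc n} (true ∷ β) h =
  trans (sum₂-subsets n _) (trans (xor-vanishʳ (sum₂-false (allSubsets n))) (sum-equal-subsets β (λ β' → h (true ∷ β'))))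
sum-equal-subsets {suc n} (false ∷ β) h =
  trans (sum₂-subsets n _) (trans (xor-vanishˡ (sum₂-zero (allSubsets n) _ unequal)) (sum-equal-subsets β (λ β' → h (false ∷ β'))))
  where
  unequal : ∀ β' → eqSubset (false ∷ β) (true ∷ β') ∧ h (true ∷ β') ≡ false
  unequal β' with subsetB β β'
  ... | true  = refl
  ... | false = refl

δ-step : ∀ n (x : Bool) (β : Subset n) (h : Subset (suc n) → Bool) →
  δ h (x ∷ β) ≡ δ (λ β' → h (x ∷ β')) β xor (x ∧ h (false ∷ β))
δ-step n true  β h = trans (sum₂-subsets n _) (cong (δ (λ β' → h (true ∷ β')) β xor_) (sum-same-size-subsets n β (λ β' → h (false ∷ β'))))
δ-step n false β h =
  trans (sum₂-subsets n _) (trans (xor-vanishˡ (sum₂-false (allSubsets n))) (sym (xor-identityʳ _)))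

δ-zero : ∀ n (β : Subset n) → δ (λ _ → false) β ≡ false
δ-zero n β = sum₂-zero (allSubsets n) _ (λ β' → ∧-zeroʳ (facetΔ β β'))

δ-ext : ∀ n (β : Subset n) {g h : Subset n → Bool} → (∀ β' → g β' ≡ h β') → δ g β ≡ δ h β
δ-ext n β agree = sum₂-ext (allSubsets n) (λ β' → cong (facetΔ β β' ∧_) (agree β'))

δ-xor : ∀ n (β : Subset n) (g h : Subset n → Bool) → δ (λ β' → g β' xor h β') β ≡ δ g β xor δ h β
δ-xor n β g h = trans (sum₂-ext (allSubsets n) (λ β' → ∧-distribˡ-xor (facetΔ β β') (g β') (h β'))) (sum₂-xor (allSubsets n) _ _)

-- δ of a function of the size only: β has |β| facets, all of size |β| - 1
δ-of-size : ∀ n (β : Subset n) (F : ℕ → Bool) → δ (λ β' → F ∣ β' ∣) β ≡ odd ∣ β ∣ ∧ F (∣ β ∣ ∸ 1)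
δ-of-size zero    []          F = refl
δ-of-size (suc n) (true ∷ β)  F =
  trans (δ-step n true β _) (trans (cong (_xor F ∣ β ∣) (δ-of-size n β (λ s → F (suc s)))) (parity-step ∣ β ∣))
  where
  parity-step : ∀ s → (odd s ∧ F (suc (s ∸ 1))) xor F s ≡ not (odd s) ∧ F s
  parity-step zero    = refl
  parity-step (suc t) = decide 2 {λ o f → (not o ∧ f) xor f} {λ o f → not (not o) ∧ f} _ (odd t) (F (suc t))
δ-of-size (suc n) (false ∷ β) F = trans (δ-step n false β _) (trans (xor-identityʳ _) (δ-of-size n β F))

-- The cone operator is a contracting homotopy of the augmented simplex:
-- δ (cone v g) + cone v (δ g) = g.
cone-homotopy : ∀ n (v : Fin n) (g : Subset n → Bool) (β : Subset n) →
  δ (cone v g) β xor (not (v ∈ᵇ β) ∧ δ g (insert v β)) ≡ g β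
cone-homotopy (suc n) zero g (true ∷ β) =
  trans (xor-identityʳ _) (trans (δ-step n true β (cone zero g)) (cong (_xor g (true ∷ β)) (δ-zero n β)))
cone-homotopy (suc n) zero g (false ∷ β) =
  trans (cong₂ _xor_ (δ-step n false β (cone zero g)) (δ-step n true β g))
        (decide 2 {λ a b → (a xor false) xor (a xor b)} {λ a b → b} _ (δ (λ β' → g (true ∷ β')) β) (g (false ∷ β)))
cone-homotopy (suc n) (suc v) g (x ∷ β) =
  trans (cong₂ _xor_ (δ-step n x β (cone (suc v) g)) (cong (not (v ∈ᵇ β) ∧_) (δ-step n x (insert v β) g)))
        (trans (decide 5 {λ a x m d g → (a xor (x ∧ (m ∧ g))) xor (m ∧ (d xor (x ∧ g)))} {λ a x m d g → a xor (m ∧ d)} _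
                  (δ (cone v (λ β' → g (x ∷ β'))) β) x (not (v ∈ᵇ β)) (δ (λ β' → g (x ∷ β')) (insert v β)) (g (false ∷ insert v β)))
               (cone-homotopy n v (λ β' → g (x ∷ β')) β))

-- reindexing along β ↦ β ∪ {v}: faces not containing v ↔ faces containing v
cone-reindex : ∀ n (v : Fin n) (F : Subset n → ℕ) →
  sumℕ (allSubsets n) (λ β → not (v ∈ᵇ β) · F (insert v β)) ≡ sumℕ (allSubsets n) (λ γ → (v ∈ᵇ γ) · F γ)
cone-reindex (suc n) zero F =
  trans (sumℕ-subsets n _) (trans (+-vanishˡ (sumℕ-0 (allSubsets n))) (sym (trans (sumℕ-subsets n _) (+-vanishʳ (sumℕ-0 (allSubsets n))))))
cone-reindex (suc n) (suc v) F =
  trans (sumℕ-subsets n _) (trans (cong₂ _+_ (cone-reindex n v (λ γ → F (true ∷ γ))) (cone-reindex n v (λ γ → F (false ∷ γ))))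
                                  (sym (sumℕ-subsets n _)))

sum-at-∅ : ∀ n (G : Subset n → ℕ) → sumℕ (allSubsets n) (λ γ → (∣ γ ∣ ≡ᵇ 0) · G γ) ≡ G (∅ n)
sum-at-∅ zero    G = +-identityʳ _
sum-at-∅ (suc n) G =
  trans (sumℕ-subsets n _) (trans (+-vanishˡ (sumℕ-0 (allSubsets n))) (sum-at-∅ n (λ γ → G (false ∷ γ))))

sum-over-vertices : ∀ n (F : Subset n → ℕ) →
  sumℕ (allFin n) (λ v → F (vertex v)) ≡ sumℕ (allSubsets n) (λ γ → (∣ γ ∣ ≡ᵇ 1) · F γ)
sum-over-vertices zero    F = refl
sum-over-vertices (suc n) F =
  trans (sumℕ-allFin-suc n _)
        (sym (trans (sumℕ-subsets n _) (cong₂ _+_ (sum-at-∅ n (λ γ → F (true ∷ γ))) (sym (sum-over-vertices n (λ γ → F (false ∷ γ)))))))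

vertex-count : ∀ n (γ : Subset n) → sumℕ (allFin n) (λ v → ⟦ v ∈ᵇ γ ⟧) ≡ ∣ γ ∣
vertex-count zero    []          = refl
vertex-count (suc n) (true ∷ γ)  = trans (sumℕ-allFin-suc n (λ v → ⟦ v ∈ᵇ (true ∷ γ) ⟧)) (cong suc (vertex-count n γ))
vertex-count (suc n) (false ∷ γ) = trans (sumℕ-allFin-suc n (λ v → ⟦ v ∈ᵇ (false ∷ γ) ⟧)) (vertex-count n γ)

-- Restricted to nonempty faces the cone operator is a homotopy up to the
-- correction coming from the empty face, which lives on the vertex {v}.
cone-homotopy-nonempty : ∀ n (v : Fin n) (g : Subset n → Bool) (β : Subset n) → nonempty β ≡ true →
  g β xor δ (λ β' → nonempty β' ∧ cone v g β') β
    ≡ (not (v ∈ᵇ β) ∧ δ (λ β' → nonempty β' ∧ g β') (insert v β)) xor ((∣ β ∣ ≡ᵇ 1) ∧ g (vertex v))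
cone-homotopy-nonempty n v g β ne-β = begin
  g β xor δ (λ β' → nonempty β' ∧ cone v g β') β
    ≡⟨ cong (g β xor_) (δ-ext n β empty-face-correction) ⟩
  g β xor δ (λ β' → cone v G β' xor ((∣ β' ∣ ≡ᵇ 0) ∧ g (vertex v))) β
    ≡⟨ cong (g β xor_) (δ-xor n β (cone v G) (λ β' → (∣ β' ∣ ≡ᵇ 0) ∧ g (vertex v))) ⟩
  g β xor (δ (cone v G) β xor δ (λ β' → (∣ β' ∣ ≡ᵇ 0) ∧ g (vertex v)) β)
    ≡⟨ cong (λ x → g β xor (δ (cone v G) β xor x)) (trans (δ-of-size n β (λ s → (s ≡ᵇ 0) ∧ g (vertex v))) (odd-size-one ∣ β ∣ _)) ⟩
  g β xor (δ (cone v G) β xor Q)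
    ≡⟨ cong (_xor (δ (cone v G) β xor Q)) (sym homotopy) ⟩
  (δ (cone v G) β xor M) xor (δ (cone v G) β xor Q)
    ≡⟨ decide 3 {λ d m q → (d xor m) xor (d xor q)} {λ d m q → m xor q} _ (δ (cone v G) β) M Q ⟩
  M xor Q ∎
  where
  open ≡-Reasoning
  G : Subset n → Bool
  G β' = nonempty β' ∧ g β'
  M : Bool
  M = not (v ∈ᵇ β) ∧ δ G (insert v β)
  Q : Bool
  Q = (∣ β ∣ ≡ᵇ 1) ∧ g (vertex v)
  homotopy : δ (cone v G) β xor M ≡ g β
  homotopy = trans (cone-homotopy n v G β) (cong (_∧ g β) ne-β)
  odd-size-one : ∀ s c → odd s ∧ (((s ∸ 1) ≡ᵇ 0) ∧ c) ≡ (s ≡ᵇ 1) ∧ c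
  odd-size-one zero          c = refl
  odd-size-one (suc zero)    c = refl
  odd-size-one (suc (suc t)) c = ∧-zeroʳ _
  empty-face-correction : ∀ β' → nonempty β' ∧ cone v g β' ≡ cone v G β' xor ((∣ β' ∣ ≡ᵇ 0) ∧ g (vertex v))
  empty-face-correction β' with ∣ β' ∣ ≡ᵇ 0 in empty
  ... | true rewrite size-zero β' (≡ᵇ-sound _ _ empty) | ∉∅ v | nonempty-insert v (∅ n) (∉∅ v) = sym (xor-same (g (vertex v)))
  ... | false with v ∈ᵇ β' in v∈β'
  ...   | true  = refl
  ...   | false rewrite nonempty-insert v β' v∈β' = sym (xor-identityʳ _)

module Product (X : CellComplex) (n : ℕ) where
  open CellComplex X

  P : CochainData
  P = X ×Δ n

  cellsX : List (Fin N)
  cellsX = allFin N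

  Cell : Set
  Cell = Fin N × Subset n

  dimP : Fin N → Subset n → ℕ
  dimP α β = dim α + (∣ β ∣ ∸ 1)

  incP : Fin N → Subset n → Fin N → Subset n → Bool
  incP α β α' β' = (does (α ≟ᶠ α') ∧ facetΔ β β') ∨ (eqSubset β β' ∧ inc α α')

  sumℕ-product : ∀ (F : Cell → ℕ) →
    sumℕ (CochainData.cells P) F ≡ sumℕ cellsX (λ α → sumℕ (allSubsets n) (λ β → nonempty β · F (α , β)))
  sumℕ-product F = trans (sumℕ-concatMap (λ α → map (α ,_) (filterᵇ nonempty (allSubsets n))) cellsX F)
    (sumℕ-ext cellsX (λ α → trans (sumℕ-map (α ,_) (filterᵇ nonempty (allSubsets n)) F)
                                  (sumℕ-filter nonempty (allSubsets n) (λ β → F (α , β)))))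

  sum₂-product : ∀ (F : Cell → Bool) →
    sum₂ (CochainData.cells P) F ≡ sum₂ cellsX (λ α → sum₂ (allSubsets n) (λ β → nonempty β ∧ F (α , β)))
  sum₂-product F = trans (sum₂-concatMap (λ α → map (α ,_) (filterᵇ nonempty (allSubsets n))) cellsX F)
    (sum₂-ext cellsX (λ α → trans (sum₂-map (α ,_) (filterᵇ nonempty (allSubsets n)) F)
                                  (sum₂-filter nonempty (allSubsets n) (λ β → F (α , β)))))

  -- the coboundary formulas of X and of the product, without the filter on
  -- the dimension of the summation cells (which is automatic, see below)
  dX : (Fin N → Bool) → Fin N → Bool
  dX g α = sum₂ cellsX (λ α' → inc α α' ∧ g α')

  dP : (Cell → Bool) → Fin N → Subset n → Bool
  dP f α β = sum₂ cellsX (λ α' → sum₂ (allSubsets n) (λ β' → nonempty β' ∧ (incP α β α' β' ∧ f (α' , β'))))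

  -- on (k+1)-cells the dimension filter is automatic, since incidences
  -- lower the dimension by one
  cobX≡dX : ∀ k g α → dim α ≡ suc k → cob toData k g α ≡ dX g α
  cobX≡dX k g α dim-α = trans (CochainFacts.cob-as-sum toData k g α) (sum₂-ext cellsX drop-filter)
    where
    drop-filter : ∀ τ → (dim τ ≡ᵇ k) ∧ (inc α τ ∧ g τ) ≡ inc α τ ∧ g τ
    drop-filter τ with inc α τ in incident
    ... | false = ∧-zeroʳ _
    ... | true rewrite ≡ᵇ-complete {dim τ} {k} (suc-injective (trans (sym (inc-dim α τ incident)) dim-α)) = refl

  facet-not-equal : ∀ (β β' : Subset n) → facetΔ β β' ∧ eqSubset β β' ≡ false
  facet-not-equal β β' with facetΔ β β' in facet | eqSubset β β' in equal
  ... | false | _     = refl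
  ... | true  | false = refl
  ... | true  | true  = ⊥-elim (1+n≢n (sym (trans (sym (cong ∣_∣ (eqSubset-sound β β' equal))) (facet-size β β' facet))))

  incP-dim : ∀ α β α' β' → nonempty β' ≡ true → incP α β α' β' ≡ true → dimP α β ≡ suc (dimP α' β')
  incP-dim α β α' β' ne-β' incident with ∨-split (does (α ≟ᶠ α') ∧ facetΔ β β') _ incident
  ... | inj₂ X-facet rewrite eqSubset-sound β β' (∧-left X-facet) | inc-dim α α' (∧-right X-facet) = refl
  ... | inj₁ Δ-facet with α ≟ᶠ α' | nonempty-size β' ne-β'
  ...   | no  _    | _         = ⊥-elim (false≢true Δ-facet)
  ...   | yes refl | t , |β'|≡ = trans (cong (λ s → dim α + (s ∸ 1)) (facet-size β β' Δ-facet)) (lower (dim α) |β'|≡)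
    where
    lower : ∀ d {b} → b ≡ suc t → d + b ≡ suc (d + (b ∸ 1))
    lower d refl = +-suc d t

  cobP≡dP : ∀ k f α β → dimP α β ≡ suc k → cob P k f (α , β) ≡ dP f α β
  cobP≡dP k f α β dim-αβ =
    trans (CochainFacts.cob-as-sum P k f (α , β))
          (trans (sum₂-product _) (sum₂-ext cellsX (λ α' → sum₂-ext (allSubsets n) (drop-filter α'))))
    where
    drop-filter : ∀ α' β' → nonempty β' ∧ ((dimP α' β' ≡ᵇ k) ∧ (incP α β α' β' ∧ f (α' , β')))
                          ≡ nonempty β' ∧ (incP α β α' β' ∧ f (α' , β'))
    drop-filter α' β' with nonempty β' in ne-β' | incP α β α' β' in incident
    ... | false | _     = refl
    ... | true  | false = ∧-zeroʳ _
    ... | true  | true  rewrite ≡ᵇ-complete {dimP α' β'} {k}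
                          (suc-injective (trans (sym (incP-dim α β α' β' ne-β' incident)) dim-αβ)) = refl

  leibniz : ∀ (f : Cell → Bool) α β → nonempty β ≡ true →
    dP f α β ≡ δ (λ β' → nonempty β' ∧ f (α , β')) β xor dX (λ α' → f (α' , β)) α
  leibniz f α β ne-β =
    trans (sum₂-ext cellsX (λ α' → trans (sum₂-ext (allSubsets n) (split α')) (sum₂-xor (allSubsets n) (Δ-part α') (X-part α'))))
    (trans (sum₂-xor cellsX (λ α' → sum₂ (allSubsets n) (Δ-part α')) (λ α' → sum₂ (allSubsets n) (X-part α')))
    (cong₂ _xor_
      (trans (sum₂-ext cellsX (λ α' → sum₂-∧ (allSubsets n) (does (α ≟ᶠ α')) (λ β' → facetΔ β β' ∧ (nonempty β' ∧ f (α' , β')))))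
             (sum₂-delta N α (λ α' → sum₂ (allSubsets n) (λ β' → facetΔ β β' ∧ (nonempty β' ∧ f (α' , β'))))))
      (sum₂-ext cellsX (λ α' → sum-equal-subsets β (λ β' → inc α α' ∧ f (α' , β'))))))
    where
    Δ-part : Fin N → Subset n → Bool
    Δ-part α' β' = does (α ≟ᶠ α') ∧ (facetΔ β β' ∧ (nonempty β' ∧ f (α' , β')))
    X-part : Fin N → Subset n → Bool
    X-part α' β' = eqSubset β β' ∧ (inc α α' ∧ f (α' , β'))
    split : ∀ α' β' → nonempty β' ∧ (incP α β α' β' ∧ f (α' , β')) ≡ Δ-part α' β' xor X-part α' β'
    split α' β' = exclusive-∨ (does (α ≟ᶠ α')) (facetΔ β β') (eqSubset β β') (nonempty β') (inc α α') (f (α' , β'))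
      (facet-not-equal β β') (λ equal → trans (cong nonempty (sym (eqSubset-sound β β' equal))) ne-β)

  dX-scale : ∀ b (h : Fin N → Bool) α → dX (λ α' → b ∧ h α') α ≡ b ∧ dX h α
  dX-scale b h α = trans (sum₂-ext cellsX (λ α' → swap (inc α α') b (h α'))) (sum₂-∧ cellsX b (λ α' → inc α α' ∧ h α'))
    where
    swap : ∀ x y z → x ∧ (y ∧ z) ≡ y ∧ (x ∧ z)
    swap = decide 3 _

  dP-⊕ : ∀ (f g : Cell → Bool) α β → dP (λ σ → f σ xor g σ) α β ≡ dP f α β xor dP g α β
  dP-⊕ f g α β =
    trans (sum₂-ext cellsX (λ α' → trans (sum₂-ext (allSubsets n) (λ β' → distrib (nonempty β') (incP α β α' β') (f (α' , β')) (g (α' , β'))))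
                                         (sum₂-xor (allSubsets n) _ _)))
          (sum₂-xor cellsX _ _)
    where
    distrib : ∀ a b x y → a ∧ (b ∧ (x xor y)) ≡ (a ∧ (b ∧ x)) xor (a ∧ (b ∧ y))
    distrib = decide 4 _

  dP-dim0 : ∀ (f : Cell → Bool) α β → dimP α β ≡ 0 → dP f α β ≡ false
  dP-dim0 f α β dim0 = sum₂-zero cellsX _ (λ α' → sum₂-zero (allSubsets n) _ (no-facet α'))
    where
    no-facet : ∀ α' β' → nonempty β' ∧ (incP α β α' β' ∧ f (α' , β')) ≡ false
    no-facet α' β' with nonempty β' in ne-β' | incP α β α' β' in incident
    ... | false | _     = refl
    ... | true  | false = refl
    ... | true  | true  = ⊥-elim (1+n≢0 (trans (sym (incP-dim α β α' β' ne-β' incident)) dim0))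

  -- The cone operator of v on the product, and the pullback along the
  -- projection X × Δ_{n-1} → X (a cochain h of X sits on every α × {v}).
  coneP : Fin n → (Cell → Bool) → Cell → Bool
  coneP v f (α , β) = not (v ∈ᵇ β) ∧ f (α , insert v β)

  pr* : (Fin N → Bool) → Cell → Bool
  pr* h (α , β) = (∣ β ∣ ≡ᵇ 1) ∧ h α

  cone-formula : ∀ v (f : Cell → Bool) α β → nonempty β ≡ true →
    f (α , β) xor dP (coneP v f) α β ≡ (not (v ∈ᵇ β) ∧ dP f α (insert v β)) xor ((∣ β ∣ ≡ᵇ 1) ∧ f (α , vertex v))
  cone-formula v f α β ne-β = begin
    f (α , β) xor dP (coneP v f) α β
      ≡⟨ cong (f (α , β) xor_) (trans (leibniz (coneP v f) α β ne-β) (cong (D xor_) (dX-scale v∉β (λ α' → f (α' , insert v β)) α))) ⟩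
    f (α , β) xor (D xor (v∉β ∧ R))
      ≡⟨ sym (xor-assoc (f (α , β)) D (v∉β ∧ R)) ⟩
    (f (α , β) xor D) xor (v∉β ∧ R)
      ≡⟨ cong (_xor (v∉β ∧ R)) (cone-homotopy-nonempty n v (λ γ → f (α , γ)) β ne-β) ⟩
    ((v∉β ∧ DG) xor Q) xor (v∉β ∧ R)
      ≡⟨ decide 3 {λ a q b → (a xor q) xor b} {λ a q b → (a xor b) xor q} _ (v∉β ∧ DG) Q (v∉β ∧ R) ⟩
    ((v∉β ∧ DG) xor (v∉β ∧ R)) xor Q
      ≡⟨ cong (_xor Q) (sym (∧-distribˡ-xor v∉β DG R)) ⟩
    (v∉β ∧ (DG xor R)) xor Q
      ≡⟨ cong (_xor Q) guarded-leibniz ⟩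
    (v∉β ∧ dP f α (insert v β)) xor Q ∎
    where
    open ≡-Reasoning
    v∉β D DG R Q : Bool
    v∉β = not (v ∈ᵇ β)
    D = δ (λ β' → nonempty β' ∧ coneP v f (α , β')) β
    DG = δ (λ β' → nonempty β' ∧ f (α , β')) (insert v β)
    R = dX (λ α' → f (α' , insert v β)) α
    Q = (∣ β ∣ ≡ᵇ 1) ∧ f (α , vertex v)
    guarded-leibniz : v∉β ∧ (DG xor R) ≡ v∉β ∧ dP f α (insert v β)
    guarded-leibniz with v ∈ᵇ β in v∈β
    ... | true  = refl
    ... | false = sym (leibniz f α (insert v β) (nonempty-insert v β v∈β))

  d-pr* : ∀ (h : Fin N → Bool) α β → nonempty β ≡ true → dP (pr* h) α β ≡ (∣ β ∣ ≡ᵇ 1) ∧ dX h α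
  d-pr* h α β ne-β = trans (leibniz (pr* h) α β ne-β)
    (cong₂ _xor_ (trans (δ-of-size n β (λ s → not (s ≡ᵇ 0) ∧ ((s ≡ᵇ 1) ∧ h α))) (vertices-only ∣ β ∣ (h α)))
                 (dX-scale (∣ β ∣ ≡ᵇ 1) h α))
    where
    vertices-only : ∀ s c → odd s ∧ (not ((s ∸ 1) ≡ᵇ 0) ∧ (((s ∸ 1) ≡ᵇ 1) ∧ c)) ≡ false
    vertices-only zero                c = refl
    vertices-only (suc zero)          c = refl
    vertices-only (suc (suc zero))    c = refl
    vertices-only (suc (suc (suc t))) c = ∧-zeroʳ _

  d-restrict : ∀ (f : Cell → Bool) α v → dP f α (vertex v) ≡ dX (λ α' → f (α' , vertex v)) α
  d-restrict f α v = trans (leibniz f α (vertex v) ne-v) (xor-vanishˡ (sum₂-zero (allSubsets n) _ only-∅))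
    where
    ne-v : nonempty (vertex v) ≡ true
    ne-v rewrite vertex-size v = refl
    only-∅ : ∀ β' → facetΔ (vertex v) β' ∧ (nonempty β' ∧ f (α , β')) ≡ false
    only-∅ β' with facetΔ (vertex v) β' in facet
    ... | false = refl
    ... | true rewrite sym (suc-injective (trans (sym (vertex-size v)) (facet-size (vertex v) β' facet))) = refl

module Counting (X : CellComplex) (n : ℕ) where
  open CellComplex X
  open Product X n

  normP-as-sum : ∀ k (f : Cell → Bool) →
    norm P k f ≡ sumℕ cellsX (λ α → sumℕ (allSubsets n) (λ β → nonempty β · ((dimP α β ≡ᵇ k) · ⟦ f (α , β) ⟧)))
  normP-as-sum k f = trans (CochainFacts.norm-as-sum P k f) (sumℕ-product _)

  normP-ext : ∀ k (f g : Cell → Bool) → (∀ α β → nonempty β ≡ true → dimP α β ≡ k → f (α , β) ≡ g (α , β)) →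
    norm P k f ≡ norm P k g
  normP-ext k f g agree =
    trans (normP-as-sum k f) (trans (sumℕ-ext cellsX (λ α → sumℕ-ext (allSubsets n) (on-cell α))) (sym (normP-as-sum k g)))
    where
    on-cell : ∀ α β → nonempty β · ((dimP α β ≡ᵇ k) · ⟦ f (α , β) ⟧) ≡ nonempty β · ((dimP α β ≡ᵇ k) · ⟦ g (α , β) ⟧)
    on-cell α β with nonempty β in ne-β | dimP α β ≡ᵇ k in is-k
    ... | false | _     = refl
    ... | true  | false = refl
    ... | true  | true  = cong ⟦_⟧ (agree α β ne-β (≡ᵇ-sound _ _ is-k))

  dimP-insert : ∀ v α β → v ∈ᵇ β ≡ false → nonempty β ≡ true → dimP α (insert v β) ≡ suc (dimP α β)
  dimP-insert v α β v∉β ne-β with nonempty-size β ne-β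
  ... | t , |β|≡ = trans (cong (λ s → dim α + (s ∸ 1)) (trans (insert-size v β v∉β) (cong suc |β|≡)))
                         (trans (+-suc (dim α) t) (cong (λ s → suc (dim α + (s ∸ 1))) (sym |β|≡)))

  dimP-vertex : ∀ α β → ∣ β ∣ ≡ 1 → dimP α β ≡ dim α
  dimP-vertex α β |β|≡1 rewrite |β|≡1 = +-identityʳ (dim α)

  -- the pullback of h has n copies of each cell of h
  norm-pr* : ∀ k (h : Fin N → Bool) → norm P k (pr* h) ≡ n * norm toData k h
  norm-pr* k h =
    trans (normP-as-sum k (pr* h))
          (trans (sumℕ-ext cellsX copies) (trans (sumℕ-* cellsX n _) (cong (n *_) (sym (CochainFacts.norm-as-sum toData k h)))))
    where
    on-vertices : ∀ d b y → not (b ≡ᵇ 0) · ((d + (b ∸ 1) ≡ᵇ k) · ⟦ (b ≡ᵇ 1) ∧ y ⟧) ≡ (b ≡ᵇ 1) · ((d ≡ᵇ k) · ⟦ y ⟧)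
    on-vertices d zero          y = refl
    on-vertices d (suc zero)    y rewrite +-identityʳ d = refl
    on-vertices d (suc (suc t)) y = ·-zero _
    copies : ∀ α → sumℕ (allSubsets n) (λ β → nonempty β · ((dimP α β ≡ᵇ k) · ⟦ pr* h (α , β) ⟧)) ≡ n * ((dim α ≡ᵇ k) · ⟦ h α ⟧)
    copies α = trans (sumℕ-ext (allSubsets n) (λ β → on-vertices (dim α) ∣ β ∣ (h α)))
      (trans (sym (sum-over-vertices n (λ _ → (dim α ≡ᵇ k) · ⟦ h α ⟧)))
      (trans (sumℕ-const (allFin n) _) (cong (_* _) (length-tabulate {n = n} (λ i → i)))))

  module Masses (k : ℕ) (φ : Cell → Bool) where
    dφ : Cell → Bool
    dφ = cob P k φ

    coneMass : Fin n → ℕ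
    coneMass v = norm P k (coneP v dφ)

    upper : Fin N → Subset n → ℕ
    upper α γ = (nonempty γ ∧ not (∣ γ ∣ ≡ᵇ 1)) · ((dimP α γ ≡ᵇ suc k) · ⟦ dφ (α , γ) ⟧)

    H : ℕ
    H = sumℕ cellsX (λ α → sumℕ (allSubsets n) (upper α))

    vertexMass : Fin n → ℕ
    vertexMass v = norm toData (suc k) (λ α → dφ (α , vertex v))

    B : ℕ
    B = sumℕ (allFin n) vertexMass

    coneMass-as-sum : ∀ v → coneMass v ≡ sumℕ cellsX (λ α → sumℕ (allSubsets n) (λ γ → (v ∈ᵇ γ) · upper α γ))
    coneMass-as-sum v =
      trans (normP-as-sum k (coneP v dφ)) (sumℕ-ext cellsX (λ α → trans (sumℕ-ext (allSubsets n) (on-cell α)) (cone-reindex n v (upper α))))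
      where
      shift : ∀ d b x → not (b ≡ᵇ 0) · ((d + (b ∸ 1) ≡ᵇ k) · x) ≡ (true ∧ not (suc b ≡ᵇ 1)) · ((d + (suc b ∸ 1) ≡ᵇ suc k) · x)
      shift d zero    x = refl
      shift d (suc t) x rewrite +-suc d t = refl
      on-cell : ∀ α β → nonempty β · ((dimP α β ≡ᵇ k) · ⟦ coneP v dφ (α , β) ⟧) ≡ not (v ∈ᵇ β) · upper α (insert v β)
      on-cell α β with v ∈ᵇ β in v∈β
      ... | true  = trans (cong (nonempty β ·_) (·-zero _)) (·-zero _)
      ... | false = trans (shift (dim α) ∣ β ∣ ⟦ dφ (α , insert v β) ⟧)
        (cong (λ s → (not (s ≡ᵇ 0) ∧ not (s ≡ᵇ 1)) · ((dim α + (s ∸ 1) ≡ᵇ suc k) · ⟦ dφ (α , insert v β) ⟧)) (sym (insert-size v β v∈β)))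

    coneMass≤H : ∀ v → coneMass v ≤ H
    coneMass≤H v rewrite coneMass-as-sum v = sumℕ-mono cellsX (λ α → sumℕ-mono (allSubsets n) (λ γ → ·-≤ (v ∈ᵇ γ) (upper α γ)))

    -- a (k+1)-cell α × γ of the product has |γ| ≤ k + 2
    face-size : ∀ α γ → ∣ γ ∣ * upper α γ ≤ suc (suc k) * upper α γ
    face-size α γ with nonempty γ ∧ not (∣ γ ∣ ≡ᵇ 1) | dimP α γ ≡ᵇ suc k in is-k+1
    ... | false | _     = ≤-reflexive (trans (*-zeroʳ ∣ γ ∣) (sym (*-zeroʳ (suc (suc k)))))
    ... | true  | false = ≤-reflexive (trans (*-zeroʳ ∣ γ ∣) (sym (*-zeroʳ (suc (suc k)))))
    ... | true  | true  = *-monoˡ-≤ _ (bound (dim α) ∣ γ ∣ (≡ᵇ-sound _ _ is-k+1))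
      where
      bound : ∀ d b → d + (b ∸ 1) ≡ suc k → b ≤ suc (suc k)
      bound d zero    _ = z≤n
      bound d (suc b) e = s≤s (subst (b ≤_) e (m≤n+m b d))

    -- every cell α × γ is counted once for each of its |γ| ≤ k + 2 vertices
    total-coneMass : sumℕ (allFin n) coneMass ≤ suc (suc k) * H
    total-coneMass = begin
      sumℕ (allFin n) coneMass
        ≡⟨ sumℕ-ext (allFin n) coneMass-as-sum ⟩
      sumℕ (allFin n) (λ v → sumℕ cellsX (λ α → sumℕ (allSubsets n) (λ γ → (v ∈ᵇ γ) · upper α γ)))
        ≡⟨ sumℕ-swap (allFin n) cellsX _ ⟩
      sumℕ cellsX (λ α → sumℕ (allFin n) (λ v → sumℕ (allSubsets n) (λ γ → (v ∈ᵇ γ) · upper α γ)))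
        ≡⟨ sumℕ-ext cellsX (λ α → sumℕ-swap (allFin n) (allSubsets n) _) ⟩
      sumℕ cellsX (λ α → sumℕ (allSubsets n) (λ γ → sumℕ (allFin n) (λ v → (v ∈ᵇ γ) · upper α γ)))
        ≡⟨ sumℕ-ext cellsX (λ α → sumℕ-ext (allSubsets n) (count-vertices α)) ⟩
      sumℕ cellsX (λ α → sumℕ (allSubsets n) (λ γ → ∣ γ ∣ * upper α γ))
        ≤⟨ sumℕ-mono cellsX (λ α → sumℕ-mono (allSubsets n) (face-size α)) ⟩
      sumℕ cellsX (λ α → sumℕ (allSubsets n) (λ γ → suc (suc k) * upper α γ))
        ≡⟨ sumℕ-ext cellsX (λ α → sumℕ-* (allSubsets n) (suc (suc k)) (upper α)) ⟩
      sumℕ cellsX (λ α → suc (suc k) * sumℕ (allSubsets n) (upper α))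
        ≡⟨ sumℕ-* cellsX (suc (suc k)) _ ⟩
      suc (suc k) * H ∎
      where
      open ≤-Reasoning
      count-vertices : ∀ α γ → sumℕ (allFin n) (λ v → (v ∈ᵇ γ) · upper α γ) ≡ ∣ γ ∣ * upper α γ
      count-vertices α γ = begin-equality
        sumℕ (allFin n) (λ v → (v ∈ᵇ γ) · upper α γ)      ≡⟨ sumℕ-ext (allFin n) (λ v → ·-as-* (v ∈ᵇ γ) (upper α γ)) ⟩
        sumℕ (allFin n) (λ v → ⟦ v ∈ᵇ γ ⟧ * upper α γ)    ≡⟨ sumℕ-ext (allFin n) (λ v → *-comm ⟦ v ∈ᵇ γ ⟧ (upper α γ)) ⟩
        sumℕ (allFin n) (λ v → upper α γ * ⟦ v ∈ᵇ γ ⟧)    ≡⟨ sumℕ-* (allFin n) (upper α γ) _ ⟩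
        upper α γ * sumℕ (allFin n) (λ v → ⟦ v ∈ᵇ γ ⟧)    ≡⟨ cong (upper α γ *_) (vertex-count n γ) ⟩
        upper α γ * ∣ γ ∣                                 ≡⟨ *-comm (upper α γ) ∣ γ ∣ ⟩
        ∣ γ ∣ * upper α γ                                 ∎

    norm-dφ : norm P (suc k) dφ ≡ H + B
    norm-dφ = trans (normP-as-sum (suc k) dφ)
      (trans (sumℕ-ext cellsX (λ α → trans (sumℕ-ext (allSubsets n) (λ γ → split (dim α) ∣ γ ∣ ⟦ dφ (α , γ) ⟧)) (sumℕ-+ (allSubsets n) _ _)))
      (trans (sumℕ-+ cellsX _ _) (cong (H +_) on-vertices)))
      where
      split : ∀ d b x → not (b ≡ᵇ 0) · ((d + (b ∸ 1) ≡ᵇ suc k) · x) ≡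
        (not (b ≡ᵇ 0) ∧ not (b ≡ᵇ 1)) · ((d + (b ∸ 1) ≡ᵇ suc k) · x) + (b ≡ᵇ 1) · ((d ≡ᵇ suc k) · x)
      split d zero          x = refl
      split d (suc zero)    x rewrite +-identityʳ d = refl
      split d (suc (suc t)) x = sym (+-identityʳ _)
      on-vertices : sumℕ cellsX (λ α → sumℕ (allSubsets n) (λ γ → (∣ γ ∣ ≡ᵇ 1) · ((dim α ≡ᵇ suc k) · ⟦ dφ (α , γ) ⟧))) ≡ B
      on-vertices = trans (sumℕ-ext cellsX (λ α → sym (sum-over-vertices n (λ γ → (dim α ≡ᵇ suc k) · ⟦ dφ (α , γ) ⟧))))
        (trans (sumℕ-swap cellsX (allFin n) _)
               (sumℕ-ext (allFin n) (λ v → sym (CochainFacts.norm-as-sum toData (suc k) (λ α → dφ (α , vertex v))))))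

    vertexMass-cob : ∀ v → norm toData (suc k) (cob toData k (λ α → φ (α , vertex v))) ≡ vertexMass v
    vertexMass-cob v = CochainFacts.norm-ext toData (suc k) _ _ on-cell
      where
      on-cell : ∀ α → dim α ≡ suc k → cob toData k (λ α → φ (α , vertex v)) α ≡ dφ (α , vertex v)
      on-cell α dim-α = trans (cobX≡dX k _ α dim-α)
        (trans (sym (d-restrict φ α v)) (sym (cobP≡dP k φ α (vertex v) (trans (dimP-vertex α (vertex v) (vertex-size v)) dim-α))))

    cone-of-d : ∀ v α β → nonempty β ≡ true → dimP α β ≡ k → (not (v ∈ᵇ β) ∧ dP φ α (insert v β)) ≡ coneP v dφ (α , β)
    cone-of-d v α β ne-β dim-αβ with v ∈ᵇ β in v∈β
    ... | true  = refl
    ... | false = sym (cobP≡dP k φ α (insert v β) (trans (dimP-insert v α β v∈β ne-β) (cong suc dim-αβ)))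

    cone-split-bound : ∀ v (F : Cell → Bool) (h : Fin N → Bool) →
      (∀ α β → nonempty β ≡ true → dimP α β ≡ k → F (α , β) ≡ coneP v dφ (α , β) xor pr* h (α , β)) →
      norm P k F ≤ coneMass v + n * norm toData k h
    cone-split-bound v F h agree = begin
      norm P k F                                              ≡⟨ normP-ext k F _ agree ⟩
      norm P k (_⊕_ P (coneP v dφ) (pr* h))                   ≤⟨ CochainFacts.norm-⊕ P k _ _ ⟩
      coneMass v + norm P k (pr* h)                           ≡⟨ cong (coneMass v +_) (norm-pr* k h) ⟩
      coneMass v + n * norm toData k h                        ∎
      where open ≤-Reasoning

    -- k = 0: φ itself is cone_v dφ plus the pullback of φ restricted to X × {v}
    vertex-bound-0 : k ≡ 0 → ∀ v → norm P k φ ≤ coneMass v + n * norm toData k (λ α → φ (α , vertex v))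
    vertex-bound-0 k≡0 v = cone-split-bound v φ _ λ α β ne-β dim-αβ → begin
      φ (α , β)                                                         ≡⟨ sym (xor-vanishʳ (dP-dim0 (coneP v φ) α β (trans dim-αβ k≡0))) ⟩
      φ (α , β) xor dP (coneP v φ) α β                                  ≡⟨ cone-formula v φ α β ne-β ⟩
      (not (v ∈ᵇ β) ∧ dP φ α (insert v β)) xor pr* (λ α → φ (α , vertex v)) (α , β)
                                                                        ≡⟨ cong (_xor _) (cone-of-d v α β ne-β dim-αβ) ⟩
      coneP v dφ (α , β) xor pr* (λ α → φ (α , vertex v)) (α , β)       ∎
      where open ≡-Reasoning

    -- k = j + 1: φ + d(cone_v φ + pr* χ) is cone_v dφ plus the pullback of φ|_{X×{v}} + dχ
    vertex-bound-suc : ∀ j → k ≡ suc j → ∀ v (χ : Fin N → Bool) →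
      norm P k (_⊕_ P φ (cob P j (_⊕_ P (coneP v φ) (pr* χ))))
        ≤ coneMass v + n * norm toData k (_⊕_ toData (λ α → φ (α , vertex v)) (cob toData j χ))
    vertex-bound-suc j k≡ v χ = cone-split-bound v _ _ λ α β ne-β dim-αβ → begin
      φ (α , β) xor cob P j ψ (α , β)
        ≡⟨ cong (φ (α , β) xor_) (cobP≡dP j ψ α β (trans dim-αβ k≡)) ⟩
      φ (α , β) xor dP ψ α β
        ≡⟨ cong (φ (α , β) xor_) (dP-⊕ (coneP v φ) (pr* χ) α β) ⟩
      φ (α , β) xor (dP (coneP v φ) α β xor dP (pr* χ) α β)
        ≡⟨ cong (λ x → φ (α , β) xor (dP (coneP v φ) α β xor x)) (trans (d-pr* χ α β ne-β) (on-vertices α β dim-αβ)) ⟩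
      φ (α , β) xor (dP (coneP v φ) α β xor (|β|≡1 β ∧ cob toData j χ α))
        ≡⟨ sym (xor-assoc (φ (α , β)) _ _) ⟩
      (φ (α , β) xor dP (coneP v φ) α β) xor (|β|≡1 β ∧ cob toData j χ α)
        ≡⟨ cong (_xor (|β|≡1 β ∧ cob toData j χ α)) (trans (cone-formula v φ α β ne-β) (cong (_xor _) (cone-of-d v α β ne-β dim-αβ))) ⟩
      (coneP v dφ (α , β) xor (|β|≡1 β ∧ φ (α , vertex v))) xor (|β|≡1 β ∧ cob toData j χ α)
        ≡⟨ xor-assoc (coneP v dφ (α , β)) _ _ ⟩
      coneP v dφ (α , β) xor ((|β|≡1 β ∧ φ (α , vertex v)) xor (|β|≡1 β ∧ cob toData j χ α))
        ≡⟨ cong (coneP v dφ (α , β) xor_) (sym (∧-distribˡ-xor (|β|≡1 β) _ _)) ⟩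
      coneP v dφ (α , β) xor (|β|≡1 β ∧ (φ (α , vertex v) xor cob toData j χ α)) ∎
      where
      open ≡-Reasoning
      ψ : Cell → Bool
      ψ = _⊕_ P (coneP v φ) (pr* χ)
      |β|≡1 : Subset n → Bool
      |β|≡1 β = ∣ β ∣ ≡ᵇ 1
      on-vertices : ∀ α β → dimP α β ≡ k → |β|≡1 β ∧ dX χ α ≡ |β|≡1 β ∧ cob toData j χ α
      on-vertices α β dim-αβ with ∣ β ∣ ≡ᵇ 1 in is-vertex
      ... | false = refl
      ... | true  = sym (cobX≡dX j χ α (trans (sym (dimP-vertex α β (≡ᵇ-sound _ _ is-vertex))) (trans dim-αβ k≡)))

module VertexAveraging (X : CellComplex) (n : ℕ) where
  open CellComplex X
  open Product X n
  open Counting X n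

  vertex-bound : ∀ k c → ExpAtLeast toData k c → ∀ φ m → IsCsyNorm P k φ m → ∀ v →
    Σ ℕ λ m-v → (m ≤ Masses.coneMass k φ v + n * m-v) × (c ℚ.* ι m-v ℚ.≤ ι (Masses.vertexMass k φ v))
  vertex-bound zero c hyp φ m norm≡ v =
    norm toData 0 φ-v ,
    subst (_≤ Masses.coneMass 0 φ v + n * norm toData 0 φ-v) norm≡ (Masses.vertex-bound-0 0 φ refl v) ,
    subst (λ b → c ℚ.* ι (norm toData 0 φ-v) ℚ.≤ ι b) (Masses.vertexMass-cob 0 φ v)
          (CochainFacts.expansion-bound toData {c = c} hyp φ-v (norm toData 0 φ-v) refl)
    where
    φ-v : Fin N → Bool
    φ-v α = φ (α , vertex v)
  vertex-bound (suc j) c hyp φ m csy v =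
    m-v ,
    ≤-trans (proj₂ csy (_⊕_ P (coneP v φ) (pr* χ))) (Masses.vertex-bound-suc (suc j) φ j refl v χ) ,
    subst (λ b → c ℚ.* ι m-v ℚ.≤ ι b) (Masses.vertexMass-cob (suc j) φ v)
          (CochainFacts.expansion-bound toData {c = c} hyp φ-v m-v ((χ , refl) , proj₂ (CosystolicMinimum.minimiser X j φ-v)))
    where
    φ-v : Fin N → Bool
    φ-v α = φ (α , vertex v)
    χ : Fin N → Bool
    χ = proj₁ (CosystolicMinimum.minimiser X j φ-v)
    m-v : ℕ
    m-v = norm toData (suc j) (_⊕_ toData φ-v (cob toData j χ))

  sum-bound : ∀ (c : ℚ.ℚ) (L : List (Fin n)) (x y : Fin n → ℕ) → (∀ v → c ℚ.* ι (x v) ℚ.≤ ι (y v)) →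
    c ℚ.* ι (sumℕ L x) ℚ.≤ ι (sumℕ L y)
  sum-bound c []      x y bounds = ℚₚ.≤-trans (ℚₚ.≤-reflexive (ℚₚ.*-zeroʳ c)) (ι-mono {0} {0} z≤n)
  sum-bound c (v ∷ L) x y bounds = begin
    c ℚ.* ι (x v + sumℕ L x)                ≡⟨ trans (cong (c ℚ.*_) (ι-+ (x v) _)) (ℚₚ.*-distribˡ-+ c _ _) ⟩
    c ℚ.* ι (x v) ℚ.+ c ℚ.* ι (sumℕ L x)    ≤⟨ ℚₚ.+-mono-≤ (bounds v) (sum-bound c L x y bounds) ⟩
    ι (y v) ℚ.+ ι (sumℕ L y)                ≡⟨ sym (ι-+ (y v) _) ⟩
    ι (y v + sumℕ L y)                      ∎
    where open ℚₚ.≤-Reasoning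

  -- Summing the vertex bounds over the n vertices, using ‖cone_v dφ‖ ≤ H and
  -- Σ_v ‖cone_v dφ‖ ≤ (k+2)·H, gives the two counting inequalities.
  averaged-bound : ∀ .{{_ : NonZero n}} k c → ExpAtLeast toData k c → ∀ φ m → IsCsyNorm P k φ m →
    Σ ℕ λ S → (m ≤ Masses.H k φ + S) × (n * m ≤ suc (suc k) * Masses.H k φ + n * S) × (c ℚ.* ι S ℚ.≤ ι (Masses.B k φ))
  averaged-bound k c hyp φ m csy = S , m≤H+S , nm≤ , sum-bound c (allFin n) m-v (Masses.vertexMass k φ) (λ v → proj₂ (proj₂ (bound v)))
    where
    open Masses k φ
    bound : ∀ v → Σ ℕ λ m-v → (m ≤ coneMass v + n * m-v) × (c ℚ.* ι m-v ℚ.≤ ι (vertexMass v))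
    bound = vertex-bound k c hyp φ m csy
    m-v : Fin n → ℕ
    m-v v = proj₁ (bound v)
    S : ℕ
    S = sumℕ (allFin n) m-v
    n-copies : ∀ a → sumℕ (allFin n) (λ _ → a) ≡ n * a
    n-copies a = trans (sumℕ-const (allFin n) a) (cong (_* a) (length-tabulate {n = n} (λ i → i)))
    sum-bounds : ∀ (f : Fin n → ℕ) → (∀ v → coneMass v ≤ f v) → n * m ≤ sumℕ (allFin n) f + n * S
    sum-bounds f cone≤f = begin
      n * m                                              ≡⟨ sym (n-copies m) ⟩
      sumℕ (allFin n) (λ _ → m)                          ≤⟨ sumℕ-mono (allFin n) (λ v → ≤-trans (proj₁ (proj₂ (bound v))) (+-monoˡ-≤ _ (cone≤f v))) ⟩
      sumℕ (allFin n) (λ v → f v + n * m-v v)            ≡⟨ sumℕ-+ (allFin n) f (λ v → n * m-v v) ⟩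
      sumℕ (allFin n) f + sumℕ (allFin n) (λ v → n * m-v v) ≡⟨ cong (sumℕ (allFin n) f +_) (sumℕ-* (allFin n) n m-v) ⟩
      sumℕ (allFin n) f + n * S                          ∎
      where open ≤-Reasoning
    m≤H+S : m ≤ H + S
    m≤H+S = *-cancelˡ-≤ n (≤-trans (sum-bounds (λ _ → H) coneMass≤H)
                                   (≤-reflexive (trans (cong (_+ n * S) (n-copies H)) (sym (*-distribˡ-+ n H S)))))
    nm≤ : n * m ≤ suc (suc k) * H + n * S
    nm≤ = ≤-trans (sum-bounds coneMass (λ _ → ≤-refl)) (+-monoˡ-≤ (n * S) total-coneMass)

open import Data.Integer using (+_)
open import Data.Rational using (ℚ; _⊓_; _⊔_; 1ℚ; _/_)

-- The averaged bounds feed the inequality in ℚ, and ‖dφ‖ = H + B.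
theorem4p4 : (X : CellComplex) (n : ℕ) → 2 ≤ n → (k : ℕ) (c : ℚ) →
    ExpAtLeast (CellComplex.toData X) k c →
    ExpAtLeast (X ×Δ n) k (c ⊓ (1ℚ ⊔ ((+ n) / suc (suc k))))
theorem4p4 X n@(suc n-1) _ k c hyp φ _ m csy =
  let S , m≤H+S , n·m≤ , c·S≤B = VertexAveraging.averaged-bound X n k c hyp φ m csy
  in subst (λ t → (c ⊓ (1ℚ ⊔ ((+ n) / suc (suc k)))) ℚ.* ι m ℚ.≤ ι t) (sym norm-dφ)
           (min-max-bound c n-1 k m H S B m≤H+S n·m≤ c·S≤B)
  where open Counting.Masses X n k φ
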